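{- For integers $n\ge k\ge 1$, $\mathrm{ex}(n,\mathcal{F}_k)=\binom{k}{2}$; that is, every graph on $n$ vertices with more than $\binom{k}{2}$ edges contains a forest with exactly $k$ edges, and there is a graph on $n$ vertices with $\binom{k}{2}$ edges containing no forest with $k$ edges.
   Context: $\mathcal{F}_k$ denotes the family of all forests with exactly $k$ edges and no isolated vertices. For a family $\mathcal{H}$, $\mathrm{ex}(n,\mathcal{H})$ is the maximum number of edges of an $n$-vertex graph containing no member of $\mathcal{H}$ as a subgraph. -}

module Defs where

open import Data.Nat using (ℕ; zero; suc; _<ᵇ_)
open import Data.Bool using (Bool; true; false; _∧_; if_then_else_)
open import Data.Fin using (Fin; toℕ; inject₁; fromℕ) renaming (zero to fzero; suc to fsuc)
open import Data.List using (List; map; concatMap; allFin)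
open import Data.Nat.ListAction using (sum)
open import Data.Product using (Σ; _×_; _,_; ∃)
open import Relation.Binary.PropositionalEquality using (_≡_)
open import Relation.Nullary using (¬_)
open import Function.Definitions using (Injective)

record Graph (n : ℕ) : Set where
  field
    adj    : Fin n → Fin n → Bool
    sym    : ∀ i j → adj i j ≡ adj j i
    irrefl : ∀ i → adj i i ≡ false
open Graph public

allPairs : (n : ℕ) → List (Fin n × Fin n)
allPairs n = concatMap (λ i → map (λ j → (i , j)) (allFin n)) (allFin n)

edgeCount : ∀ {n} → Graph n → ℕ
edgeCount {n} G =
  sum (map (λ { (i , j) → if (toℕ i <ᵇ toℕ j) ∧ adj G i j then 1 else 0 }) (allPairs n))

Cycle : ∀ {n} → Graph n → Set
Cycle {n} G = Σ ℕ λ m → Σ (Fin (suc (suc (suc m))) → Fin n) λ c →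
    Injective _≡_ _≡_ c
  × (∀ (i : Fin (suc (suc m))) → adj G (c (inject₁ i)) (c (fsuc i)) ≡ true)
  × adj G (c (fromℕ (suc (suc m)))) (c fzero) ≡ true

Forest : ∀ {n} → Graph n → Set
Forest G = ¬ Cycle G

NoIsolated : ∀ {n} → Graph n → Set
NoIsolated {n} G = ∀ (v : Fin n) → ∃ λ (u : Fin n) → adj G v u ≡ true

_⊆G_ : ∀ {m n} → Graph m → Graph n → Set
_⊆G_ {m} {n} F G = Σ (Fin m → Fin n) λ f →
  Injective _≡_ _≡_ f × (∀ i j → adj F i j ≡ true → adj G (f i) (f j) ≡ true)

InFk : ℕ → ∀ {m} → Graph m → Set
InFk k F = Forest F × NoIsolated F × edgeCount F ≡ k

ContainsFk : ℕ → ∀ {n} → Graph n → Set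
ContainsFk k G = Σ ℕ λ m → Σ (Graph m) λ F → InFk k F × F ⊆G G

-- Upper bound, by induction on k. If some vertex has degree ≥ k, a star with k edges is a
-- member of 𝓕_k. Otherwise delete a non-isolated vertex v: the degree sum drops by at most
-- 2(k - 1) = 2(C(k,2) - C(k-1,2)), so G - v contains a forest with k - 1 edges, which an edge at
-- v extends (as a pendant edge, or as a new component). Acyclicity is certified by ranks: if every
-- vertex has at most one neighbour of rank at least its own, the least-ranked vertex of a cycle
-- cannot exist. Each new vertex gets the lowest rank and at most one neighbour; the centre of a
-- star is ranked above its leaves.
--
-- Lower bound: K_k plus n - k isolated vertices has C(k,2) edges. A member of 𝓕_k inside it has
-- no isolated vertex, so it lives on at most k vertices while having k edges. A graph with at
-- least as many edges as vertices has a cycle: strip vertices of degree ≤ 1 and then follow a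
-- non-backtracking walk until it first revisits a vertex.
module Submission where

open import Defs renaming (sym to adj-sym; irrefl to adj-irrefl)
open import Data.Bool using (Bool; true; false; T; _∧_; if_then_else_)
open import Data.Fin using (Fin; toℕ; punchIn; inject₁; fromℕ; fromℕ<)
  renaming (zero to fzero; suc to fsuc)
open import Data.Fin.Properties
  using ( toℕ-injective; suc-injective; _≟_; punchIn-injective; punchInᵢ≢i; toℕ-inject₁
        ; toℕ-fromℕ; toℕ-fromℕ<; fromℕ<-injective; toℕ<n; any?; pigeonhole; injective⇒≤ )
open import Data.Fin.Relation.Unary.Top using (view; ‵fromℕ; ‵inject₁)
open import Data.List using (List; _++_; map; concatMap; tabulate; allFin)
open import Data.List.Properties using (map-++; map-∘)
open import Data.List.Membership.Propositional.Properties using (∈-allFin)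
import Data.List.Relation.Unary.All as All
open import Data.Nat
  using (ℕ; zero; suc; _+_; _*_; _∸_; _<ᵇ_; _≤_; _<_; _≤?_; z≤n; s≤s; z<s; s≤s⁻¹)
open import Data.Nat.Combinatorics using (_C_; nCk+nC[k+1]≡[n+1]C[k+1]; nC1≡n)
import Data.Nat.ListAction as List
open import Data.Nat.ListAction.Properties using (sum-++)
open import Data.Nat.Properties hiding (suc-injective; _≟_)
open import Data.List.Extrema ≤-totalOrder using (argmin; f[argmin]≤f[xs])
open import Algebra.Properties.CommutativeMonoid.Sum +-0-commutativeMonoid
  using (∑-distrib-+; ∑-comm; sum-remove; sum-cong-≗; sum-replicate-zero)
  renaming (sum to ∑)
open import Data.Product using (Σ; ∃; ∃₂; _×_; _,_; proj₁; proj₂)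
open import Data.Sum using (_⊎_; inj₁; inj₂; [_,_]′)
open import Data.Vec.Functional using (_∷_)
open import Function using (_∘_; id)
open import Function.Definitions using (Injective)
open import Relation.Binary.Definitions using (tri<; tri≈; tri>)
open import Relation.Binary.PropositionalEquality
open import Relation.Nullary using (¬_; Dec; contradiction; does; yes; no)
open import Relation.Nullary.Decidable using (dec-true)
open import Relation.Nullary.Reflects using (ofʸ; ofⁿ)

private
  variable
    A B : Set
    m n n′ : ℕ

∷-injective : {w : A} {f : Fin n → A} → (∀ i → f i ≢ w) →
  Injective _≡_ _≡_ f → Injective _≡_ _≡_ (w ∷ f)
∷-injective w∉f f-inj {fzero}  {fzero}  _  = refl
∷-injective w∉f f-inj {fzero}  {fsuc j} eq = contradiction (sym eq) (w∉f j)
∷-injective w∉f f-inj {fsuc i} {fzero}  eq = contradiction eq (w∉f i)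
∷-injective w∉f f-inj {fsuc i} {fsuc j} eq = cong fsuc (f-inj eq)

module _ {p} {P : ℕ → Set p} (P? : ∀ b → Dec (P b)) where

  private
    leastBelow : ∀ N → (∃ λ b → P b × (∀ {c} → c < b → ¬ P c)) ⊎ (∀ {c} → c < N → ¬ P c)
    leastBelow zero = inj₂ λ ()
    leastBelow (suc N) with leastBelow N
    ... | inj₁ found = inj₁ found
    ... | inj₂ none with P? N
    ...   | yes pN = inj₁ (N , pN , none)
    ...   | no ¬pN = inj₂ λ c<1+N → [ none , (λ { refl → ¬pN }) ]′ (m≤n⇒m<n∨m≡n (s≤s⁻¹ c<1+N))

  leastWitness : ∀ {b} → P b → ∃ λ b′ → P b′ × (∀ {c} → c < b′ → ¬ P c)
  leastWitness {b} pb with leastBelow (suc b)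
  ... | inj₁ found = found
  ... | inj₂ none  = contradiction pb (none ≤-refl)

m+n<o+p⇒o≤n⇒m<p : ∀ {m n o p} → m + n < o + p → o ≤ n → m < p
m+n<o+p⇒o≤n⇒m<p {m} {n} {o} {p} lt o≤n = +-cancelʳ-< n m p (begin-strict
  m + n <⟨ lt ⟩
  o + p ≤⟨ +-monoˡ-≤ p o≤n ⟩
  n + p ≡⟨ +-comm n p ⟩
  p + n ∎)
  where open ≤-Reasoning

m+n≤o+p⇒o≤n⇒m≤p : ∀ {m n o p} → m + n ≤ o + p → o ≤ n → m ≤ p
m+n≤o+p⇒o≤n⇒m≤p {m} {n} {o} {p} le o≤n = +-cancelʳ-≤ n m p (begin
  m + n ≤⟨ le ⟩
  o + p ≤⟨ +-monoˡ-≤ p o≤n ⟩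
  n + p ≡⟨ +-comm n p ⟩
  p + n ∎)
  where open ≤-Reasoning

[1+k]C2≡kC2+k : ∀ k → suc k C 2 ≡ k C 2 + k
[1+k]C2≡kC2+k k = begin
  suc k C 2       ≡⟨ nCk+nC[k+1]≡[n+1]C[k+1] k 1 ⟨
  k C 1 + k C 2   ≡⟨ cong (_+ k C 2) (nC1≡n k) ⟩
  k + k C 2       ≡⟨ +-comm k _ ⟩
  k C 2 + k ∎
  where open ≡-Reasoning

0<∑⇒∃ : (f : Fin n → ℕ) → 0 < ∑ f → ∃ λ i → 0 < f i
0<∑⇒∃ {suc n} f 0<∑ with f fzero in f0
... | suc _ = fzero , subst (0 <_) (sym f0) z<s
... | zero with i , 0<fi ← 0<∑⇒∃ (f ∘ fsuc) 0<∑ = fsuc i , 0<fi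

sum-map-tabulate : (φ : A → ℕ) (h : Fin n → A) → List.sum (map φ (tabulate h)) ≡ ∑ (φ ∘ h)
sum-map-tabulate {n = zero}  φ h = refl
sum-map-tabulate {n = suc n} φ h = cong (φ (h fzero) +_) (sum-map-tabulate φ (h ∘ fsuc))

sum-map-concatMap-tabulate : (φ : A → ℕ) (F : B → List A) (h : Fin n → B) →
  List.sum (map φ (concatMap F (tabulate h))) ≡ ∑ (λ i → List.sum (map φ (F (h i))))
sum-map-concatMap-tabulate {n = zero}  φ F h = refl
sum-map-concatMap-tabulate {n = suc n} φ F h = begin
  List.sum (map φ (F (h fzero) ++ concatMap F (tabulate (h ∘ fsuc))))
    ≡⟨ cong List.sum (map-++ φ (F (h fzero)) _) ⟩
  List.sum (map φ (F (h fzero)) ++ map φ (concatMap F (tabulate (h ∘ fsuc))))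
    ≡⟨ sum-++ (map φ (F (h fzero))) _ ⟩
  List.sum (map φ (F (h fzero))) + List.sum (map φ (concatMap F (tabulate (h ∘ fsuc))))
    ≡⟨ cong (List.sum (map φ (F (h fzero))) +_) (sum-map-concatMap-tabulate φ F (h ∘ fsuc)) ⟩
  ∑ (λ i → List.sum (map φ (F (h i)))) ∎
  where open ≡-Reasoning

sum-allPairs : (φ : Fin n × Fin n → ℕ) →
  List.sum (map φ (allPairs n)) ≡ ∑ λ i → ∑ λ j → φ (i , j)
sum-allPairs {n} φ =
  trans (sum-map-concatMap-tabulate {n = n} φ (λ i → map (i ,_) (allFin n)) id)
        (sum-cong-≗ λ i → trans (cong List.sum (sym (map-∘ (allFin n))))
                                (sum-map-tabulate (φ ∘ (i ,_)) id))

𝟙 : Bool → ℕ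
𝟙 b = if b then 1 else 0

count : (Fin n → Bool) → ℕ
count P = ∑ (𝟙 ∘ P)

count-true : ∀ n → count {n} (λ _ → true) ≡ n
count-true zero    = refl
count-true (suc n) = cong suc (count-true n)

count-<ᵇ : ∀ {k n} → k ≤ n → count {n} (λ j → toℕ j <ᵇ k) ≡ k
count-<ᵇ {zero}  {n}     _   = sum-replicate-zero n
count-<ᵇ {suc k} {suc n} k<n = cong suc (count-<ᵇ (s≤s⁻¹ k<n))

single : Fin n → Fin n → Bool
single i j = does (j ≟ i)

count-single : (i : Fin n) → count (single i) ≡ 1
count-single {suc n} fzero    = cong suc (sum-replicate-zero n)
count-single         (fsuc i) = count-single i

single-≡ : (i j : Fin n) → single i j ≡ true → j ≡ i
single-≡ i j p with j ≟ i
... | yes j≡i = j≡i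
... | no  _   = contradiction p λ ()

single-unique : (i : Fin n) → ∀ j j′ → single i j ≡ true → single i j′ ≡ true → j ≡ j′
single-unique i j j′ p q = trans (single-≡ i j p) (sym (single-≡ i j′ q))

single-self : (i : Fin n) → single i i ≡ true
single-self i = dec-true (i ≟ i) refl

≤count⇒injection : ∀ k (P : Fin n → Bool) → k ≤ count P →
  Σ (Fin k → Fin n) λ g → Injective _≡_ _≡_ g × (∀ t → P (g t) ≡ true)
≤count⇒injection zero    P _ = (λ ()) , (λ { {()} }) , (λ ())
≤count⇒injection {suc n} (suc k) P k<count with P fzero in P0
... | true  with g , g-inj , Pg ← ≤count⇒injection k (P ∘ fsuc) (s≤s⁻¹ k<count)
  = fzero ∷ fsuc ∘ g , ∷-injective (λ _ ()) (g-inj ∘ suc-injective)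
  , λ { fzero → P0 ; (fsuc t) → Pg t }
... | false with g , g-inj , Pg ← ≤count⇒injection (suc k) (P ∘ fsuc) k<count
  = fsuc ∘ g , g-inj ∘ suc-injective , Pg

degree : Graph n → Fin n → ℕ
degree G v = count (adj G v)

degreeSum : Graph n → ℕ
degreeSum G = ∑ (degree G)

adj⇒≢ : (G : Graph n) {u v : Fin n} → adj G u v ≡ true → u ≢ v
adj⇒≢ G {u} uv refl = contradiction (trans (sym uv) (adj-irrefl G u)) λ ()

ascendingEdge : Graph n → Fin n → Fin n → ℕ
ascendingEdge G i j = 𝟙 ((toℕ i <ᵇ toℕ j) ∧ adj G i j)

adjacency-split : (G : Graph n) (i j : Fin n) →
  𝟙 (adj G i j) ≡ ascendingEdge G i j + ascendingEdge G j i
adjacency-split G i j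
  with toℕ i <ᵇ toℕ j | <ᵇ-reflects-< (toℕ i) (toℕ j)
     | toℕ j <ᵇ toℕ i | <ᵇ-reflects-< (toℕ j) (toℕ i)
... | true  | ofʸ i<j | true  | ofʸ j<i = contradiction j<i (<-asym i<j)
... | true  | _       | false | _       = sym (+-identityʳ _)
... | false | _       | true  | _       = cong 𝟙 (adj-sym G i j)
... | false | ofⁿ i≮j | false | ofⁿ j≮i
  with refl ← toℕ-injective (≤-antisym (≮⇒≥ j≮i) (≮⇒≥ i≮j)) = cong 𝟙 (adj-irrefl G i)

handshake : (G : Graph n) → 2 * edgeCount G ≡ degreeSum G
handshake {n} G = begin
  2 * edgeCount G                ≡⟨ cong (2 *_) (sum-allPairs {n} _) ⟩
  E + (E + 0)                    ≡⟨ cong (E +_) (+-identityʳ E) ⟩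
  E + E                          ≡⟨ cong (E +_) (∑-comm (ascendingEdge G)) ⟩
  E + ∑ (λ i → ∑ λ j → ascendingEdge G j i)
    ≡⟨ ∑-distrib-+ (λ i → ∑ (ascendingEdge G i)) _ ⟨
  ∑ (λ i → ∑ (ascendingEdge G i) + ∑ λ j → ascendingEdge G j i)
    ≡⟨ sum-cong-≗ (λ i → sym (∑-distrib-+ (ascendingEdge G i) _)) ⟩
  ∑ (λ i → ∑ λ j → ascendingEdge G i j + ascendingEdge G j i)
    ≡⟨ sum-cong-≗ (λ i → sum-cong-≗ λ j → sym (adjacency-split G i j)) ⟩
  degreeSum G ∎
  where
  open ≡-Reasoning
  E = ∑ λ i → ∑ λ j → ascendingEdge G i j

edgeless : ∀ n → Graph n
edgeless n = record { adj = λ _ _ → false ; sym = λ _ _ → refl ; irrefl = λ _ → refl }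

removeVertex : Fin (suc n) → Graph (suc n) → Graph n
removeVertex v G = record
  { adj    = λ i j → adj G (punchIn v i) (punchIn v j)
  ; sym    = λ i j → adj-sym G (punchIn v i) (punchIn v j)
  ; irrefl = λ i → adj-irrefl G (punchIn v i) }

-- The new vertex is fzero; N is its neighbourhood among the old vertices.
addVertex : (Fin n → Bool) → Graph n → Graph (suc n)
addVertex {n} N G = record { adj = adj′ ; sym = sym′ ; irrefl = irrefl′ }
  where
  adj′ : Fin (suc n) → Fin (suc n) → Bool
  adj′ fzero    fzero    = false
  adj′ fzero    (fsuc j) = N j
  adj′ (fsuc i) fzero    = N i
  adj′ (fsuc i) (fsuc j) = adj G i j
  sym′ : ∀ i j → adj′ i j ≡ adj′ j i
  sym′ fzero    fzero    = refl
  sym′ fzero    (fsuc j) = refl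
  sym′ (fsuc i) fzero    = refl
  sym′ (fsuc i) (fsuc j) = adj-sym G i j
  irrefl′ : ∀ i → adj′ i i ≡ false
  irrefl′ fzero    = refl
  irrefl′ (fsuc i) = adj-irrefl G i

degreeSum-edgeless : ∀ n → degreeSum (edgeless n) ≡ 0
degreeSum-edgeless n = trans (sum-cong-≗ {n} λ _ → sum-replicate-zero n) (sum-replicate-zero n)

degreeSum-removeVertex : (v : Fin (suc n)) (G : Graph (suc n)) →
  degreeSum G ≡ 2 * degree G v + degreeSum (removeVertex v G)
degreeSum-removeVertex {n} v G = begin
  degreeSum G
    ≡⟨ sum-remove {i = v} (degree G) ⟩
  d + ∑ (degree G ∘ punchIn v)
    ≡⟨ cong (d +_) (sum-cong-≗ {n} λ i → sum-remove {i = v} (𝟙 ∘ adj G (punchIn v i))) ⟩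
  d + ∑ (λ i → 𝟙 (adj G (punchIn v i) v) + degree G′ i)
    ≡⟨ cong (d +_) (∑-distrib-+ _ (degree G′)) ⟩
  d + (∑ (λ i → 𝟙 (adj G (punchIn v i) v)) + degreeSum G′)
    ≡⟨ cong (λ x → d + (x + degreeSum G′)) d≡ ⟨
  d + (d + degreeSum G′)
    ≡⟨ +-assoc d d _ ⟨
  d + d + degreeSum G′
    ≡⟨ cong (λ x → d + x + degreeSum G′) (+-identityʳ d) ⟨
  2 * d + degreeSum G′ ∎
  where
  open ≡-Reasoning
  d = degree G v
  G′ = removeVertex v G
  d≡ : d ≡ ∑ (λ i → 𝟙 (adj G (punchIn v i) v))
  d≡ = begin
    d
      ≡⟨ sum-remove {i = v} (𝟙 ∘ adj G v) ⟩
    𝟙 (adj G v v) + ∑ (𝟙 ∘ adj G v ∘ punchIn v)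
      ≡⟨ cong (λ b → 𝟙 b + ∑ (𝟙 ∘ adj G v ∘ punchIn v)) (adj-irrefl G v) ⟩
    ∑ (𝟙 ∘ adj G v ∘ punchIn v)
      ≡⟨ sum-cong-≗ {n} (λ i → cong 𝟙 (adj-sym G v (punchIn v i))) ⟩
    ∑ (λ i → 𝟙 (adj G (punchIn v i) v)) ∎

degreeSum-addVertex : (N : Fin n → Bool) (G : Graph n) →
  degreeSum (addVertex N G) ≡ 2 * count N + degreeSum G
degreeSum-addVertex N G = begin
  count N + ∑ (λ i → 𝟙 (N i) + degree G i)
    ≡⟨ cong (count N +_) (∑-distrib-+ (𝟙 ∘ N) (degree G)) ⟩
  count N + (count N + degreeSum G)
    ≡⟨ +-assoc (count N) _ _ ⟨
  count N + count N + degreeSum G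
    ≡⟨ cong (λ x → count N + x + degreeSum G) (+-identityʳ _) ⟨
  2 * count N + degreeSum G ∎
  where open ≡-Reasoning

⊆G-trans : {F : Graph m} {G : Graph n} {H : Graph n′} → F ⊆G G → G ⊆G H → F ⊆G H
⊆G-trans (f , f-inj , f-adj) (g , g-inj , g-adj) =
  g ∘ f , f-inj ∘ g-inj , λ i j → g-adj (f i) (f j) ∘ f-adj i j

removeVertex-⊆G : (v : Fin (suc n)) (G : Graph (suc n)) → removeVertex v G ⊆G G
removeVertex-⊆G v G = punchIn v , punchIn-injective v _ _ , λ _ _ → id

edgeless-⊆G : {G : Graph n} {f : Fin m → Fin n} → Injective _≡_ _≡_ f → edgeless m ⊆G G
edgeless-⊆G {f = f} f-inj = f , f-inj , λ _ _ ()

addVertex-⊆G : {N : Fin m → Bool} {F : Graph m} {G : Graph n} (e : F ⊆G G) {w : Fin n} →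
  (∀ i → proj₁ e i ≢ w) → (∀ j → N j ≡ true → adj G w (proj₁ e j) ≡ true) →
  addVertex N F ⊆G G
addVertex-⊆G {N = N} {F} {G} (f , f-inj , f-adj) {w} w∉f w-adj =
  w ∷ f , ∷-injective w∉f f-inj , adj′
  where
  adj′ : ∀ i j → adj (addVertex N F) i j ≡ true → adj G ((w ∷ f) i) ((w ∷ f) j) ≡ true
  adj′ fzero    fzero    ()
  adj′ fzero    (fsuc j) = w-adj j
  adj′ (fsuc i) fzero    = trans (adj-sym G (f i) w) ∘ w-adj i
  adj′ (fsuc i) (fsuc j) = f-adj i j

cycle-⊆G : {F : Graph m} {G : Graph n} → F ⊆G G → Cycle F → Cycle G
cycle-⊆G (f , f-inj , f-adj) (ℓ , c , c-inj , c-adj , c-close) =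
  ℓ , f ∘ c , c-inj ∘ f-inj , (λ i → f-adj _ _ (c-adj i)) , f-adj _ _ c-close

-- Forests certified by ranks

AtMostOneNeighbourAbove : (Fin m → ℕ) → Graph m → Set
AtMostOneNeighbourAbove r F = ∀ i j j′ → r i ≤ r j → r i ≤ r j′ →
  adj F i j ≡ true → adj F i j′ ≡ true → j ≡ j′

cycle-neighbours : (G : Graph n) (ℓ : ℕ) (c : Fin (3 + ℓ) → Fin n) →
  (∀ (i : Fin (2 + ℓ)) → adj G (c (inject₁ i)) (c (fsuc i)) ≡ true) →
  adj G (c (fromℕ (2 + ℓ))) (c fzero) ≡ true →
  ∀ t → ∃₂ λ a b → a ≢ b × adj G (c t) (c a) ≡ true × adj G (c t) (c b) ≡ true
cycle-neighbours G ℓ c step close fzero =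
  fsuc fzero , fromℕ (2 + ℓ) , (λ ()) , step fzero , trans (adj-sym G _ _) close
cycle-neighbours G ℓ c step close (fsuc t) with view t
... | ‵fromℕ =
  inject₁ (fromℕ (suc ℓ)) , fzero , (λ ()) , trans (adj-sym G _ _) (step (fromℕ (suc ℓ))) , close
... | ‵inject₁ s =
  inject₁ (inject₁ s) , fsuc (fsuc s) , before≢after ,
  trans (adj-sym G _ _) (step (inject₁ s)) , step (fsuc s)
  where
  before≢after : inject₁ (inject₁ s) ≢ fsuc (fsuc s)
  before≢after eq = m≢1+n+m (toℕ s) {1} (begin
    toℕ s                     ≡⟨ toℕ-inject₁ s ⟨
    toℕ (inject₁ s)           ≡⟨ toℕ-inject₁ (inject₁ s) ⟨
    toℕ (inject₁ (inject₁ s)) ≡⟨ cong toℕ eq ⟩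
    suc (suc (toℕ s))         ∎)
    where open ≡-Reasoning

atMostOneNeighbourAbove⇒forest : {r : Fin m → ℕ} {F : Graph m} →
  AtMostOneNeighbourAbove r F → Forest F
atMostOneNeighbourAbove⇒forest {r = r} {F} unique (ℓ , c , c-inj , step , close) =
  let a , b , a≢b , adj-a , adj-b = cycle-neighbours F ℓ c step close t₀
  in  a≢b (c-inj (unique (c t₀) (c a) (c b) (least a) (least b) adj-a adj-b))
  where
  t₀ : Fin (3 + ℓ)
  t₀ = argmin (r ∘ c) fzero (allFin (3 + ℓ))
  least : ∀ s → r (c t₀) ≤ r (c s)
  least s = All.lookup (f[argmin]≤f[xs] {f = r ∘ c} fzero (allFin (3 + ℓ))) (∈-allFin s)

addVertex-atMostOneNeighbourAbove : {N : Fin m → Bool} {r : Fin m → ℕ} {F : Graph m} →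
  (∀ j j′ → N j ≡ true → N j′ ≡ true → j ≡ j′) →
  AtMostOneNeighbourAbove r F → AtMostOneNeighbourAbove (0 ∷ suc ∘ r) (addVertex N F)
addVertex-atMostOneNeighbourAbove N-unique unique fzero (fsuc j) (fsuc j′) _ _ Nj Nj′ =
  cong fsuc (N-unique j j′ Nj Nj′)
addVertex-atMostOneNeighbourAbove N-unique unique (fsuc i) (fsuc j) (fsuc j′) ij ij′ e e′ =
  cong fsuc (unique i j j′ (s≤s⁻¹ ij) (s≤s⁻¹ ij′) e e′)
addVertex-atMostOneNeighbourAbove N-unique unique fzero    fzero    _        _ _ ()
addVertex-atMostOneNeighbourAbove N-unique unique fzero    (fsuc _) fzero    _ _ _ ()
addVertex-atMostOneNeighbourAbove N-unique unique (fsuc _) fzero    _        ()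
addVertex-atMostOneNeighbourAbove N-unique unique (fsuc _) (fsuc _) fzero    _ ()

star : ∀ k → Graph (suc k)
star k = addVertex (λ _ → true) (edgeless k)

star-atMostOneNeighbourAbove : ∀ k → AtMostOneNeighbourAbove (1 ∷ λ _ → 0) (star k)
star-atMostOneNeighbourAbove k (fsuc _) fzero    fzero    _ _ _ _ = refl
star-atMostOneNeighbourAbove k fzero    fzero    _        _ _ ()
star-atMostOneNeighbourAbove k fzero    (fsuc _) _        ()
star-atMostOneNeighbourAbove k (fsuc _) fzero    (fsuc _) _ _ _ ()
star-atMostOneNeighbourAbove k (fsuc _) (fsuc _) _        _ _ ()

-- Many edges force a forest with k edges

record RankedForestIn (k : ℕ) (G : Graph n) : Set where
  field
    order      : ℕ
    forest     : Graph order
    rank       : Fin order → ℕ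
    ranked     : AtMostOneNeighbourAbove rank forest
    noIsolated : NoIsolated forest
    degreeSum≡ : degreeSum forest ≡ 2 * k
    embedding  : forest ⊆G G

  vertexMap : Fin order → Fin n
  vertexMap = proj₁ embedding

  Avoids : Fin n → Set
  Avoids v = ∀ i → vertexMap i ≢ v

open RankedForestIn

rankedForestIn⇒containsFk : {G : Graph n} → ∀ k → RankedForestIn k G → ContainsFk k G
rankedForestIn⇒containsFk k W =
  order W , forest W ,
  ( atMostOneNeighbourAbove⇒forest {r = rank W} {forest W} (ranked W) , noIsolated W
  , *-cancelˡ-≡ _ k 2 (trans (handshake (forest W)) (degreeSum≡ W)) ) ,
  embedding W

rankedForestIn-mono : {G : Graph m} {H : Graph n} → ∀ {k} →
  RankedForestIn k G → G ⊆G H → RankedForestIn k H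
rankedForestIn-mono {G = G} {H} W e = record
  { order = order W ; forest = forest W ; rank = rank W ; ranked = ranked W
  ; noIsolated = noIsolated W ; degreeSum≡ = degreeSum≡ W
  ; embedding = ⊆G-trans {F = forest W} {G} {H} (embedding W) e }

emptyForestIn : (G : Graph n) → RankedForestIn 0 G
emptyForestIn G = record
  { order = 0 ; forest = edgeless 0 ; rank = λ () ; ranked = λ () ; noIsolated = λ ()
  ; degreeSum≡ = refl ; embedding = edgeless-⊆G {G = G} {f = λ ()} (λ { {()} }) }

starForestIn : (G : Graph n) {w : Fin n} → ∀ k → suc k ≤ degree G w → RankedForestIn (suc k) G
starForestIn G {w} k big with g , g-inj , w~g ← ≤count⇒injection (suc k) (adj G w) big = record
  { order = 2 + k ; forest = star (suc k) ; rank = 1 ∷ λ _ → 0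
  ; ranked = star-atMostOneNeighbourAbove (suc k)
  ; noIsolated = λ { fzero → fsuc fzero , refl ; (fsuc _) → fzero , refl }
  ; degreeSum≡ = begin
      degreeSum (star (suc k))
        ≡⟨ degreeSum-addVertex (λ _ → true) (edgeless (suc k)) ⟩
      2 * count {suc k} (λ _ → true) + degreeSum (edgeless (suc k))
        ≡⟨ cong₂ (λ d s → 2 * d + s) (count-true (suc k)) (degreeSum-edgeless (suc k)) ⟩
      2 * suc k + 0
        ≡⟨ +-identityʳ _ ⟩
      2 * suc k ∎
  ; embedding = addVertex-⊆G {N = λ _ → true} {G = G} (edgeless-⊆G {G = G} g-inj)
                  (λ t → adj⇒≢ G (w~g t) ∘ sym) (λ t _ → w~g t) }
  where open ≡-Reasoning

attachLeaf : {G : Graph n} {k : ℕ} (W : RankedForestIn k G) {v : Fin n} → Avoids W v →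
  (i₀ : Fin (order W)) → adj G v (vertexMap W i₀) ≡ true → RankedForestIn (suc k) G
attachLeaf {G = G} {k} W {v} v∉W i₀ v~i₀ = record
  { order = suc (order W) ; forest = addVertex N (forest W) ; rank = 0 ∷ suc ∘ rank W
  ; ranked = addVertex-atMostOneNeighbourAbove {r = rank W} (single-unique i₀) (ranked W)
  ; noIsolated = λ { fzero → fsuc i₀ , single-self i₀
                   ; (fsuc i) → fsuc (proj₁ (noIsolated W i)) , proj₂ (noIsolated W i) }
  ; degreeSum≡ = begin
      degreeSum (addVertex N (forest W))
        ≡⟨ degreeSum-addVertex N (forest W) ⟩
      2 * count N + degreeSum (forest W)
        ≡⟨ cong₂ (λ d s → 2 * d + s) (count-single i₀) (degreeSum≡ W) ⟩
      2 + 2 * k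
        ≡⟨ *-suc 2 k ⟨
      2 * suc k ∎
  ; embedding = addVertex-⊆G {N = N} {G = G} (embedding W) v∉W
      (λ j Nj → subst (λ i → adj G v (vertexMap W i) ≡ true) (sym (single-≡ i₀ j Nj)) v~i₀) }
  where
  open ≡-Reasoning
  N = single i₀

addEdge : {G : Graph n} {k : ℕ} (W : RankedForestIn k G) {v u : Fin n} →
  Avoids W v → Avoids W u → adj G v u ≡ true → RankedForestIn (suc k) G
addEdge {G = G} {k} W {v} {u} v∉W u∉W v~u = record
  { order = 2 + order W ; forest = addVertex N F₁
  ; rank = 0 ∷ suc ∘ (0 ∷ suc ∘ rank W)
  ; ranked = addVertex-atMostOneNeighbourAbove {r = 0 ∷ suc ∘ rank W} (single-unique fzero)
               (addVertex-atMostOneNeighbourAbove {r = rank W} (λ _ _ ()) (ranked W))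
  ; noIsolated = λ { fzero → fsuc fzero , refl ; (fsuc fzero) → fzero , refl
                   ; (fsuc (fsuc i)) → fsuc (fsuc (proj₁ (noIsolated W i)))
                                     , proj₂ (noIsolated W i) }
  ; degreeSum≡ = begin
      degreeSum (addVertex N F₁)
        ≡⟨ degreeSum-addVertex N F₁ ⟩
      2 * count N + degreeSum F₁
        ≡⟨ cong₂ (λ d s → 2 * d + s) (count-single {suc (order W)} fzero)
                 (degreeSum-addVertex (λ _ → false) (forest W)) ⟩
      2 + (2 * count {order W} (λ _ → false) + degreeSum (forest W))
        ≡⟨ cong₂ (λ d s → 2 + (2 * d + s)) (sum-replicate-zero (order W)) (degreeSum≡ W) ⟩
      2 + 2 * k
        ≡⟨ *-suc 2 k ⟨
      2 * suc k ∎
  ; embedding = addVertex-⊆G {N = N} {G = G} e₁ v∉e₁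
      (λ j Nj → subst (λ i → adj G v (proj₁ e₁ i) ≡ true) (sym (single-≡ fzero j Nj)) v~u) }
  where
  open ≡-Reasoning
  N = single fzero
  F₁ = addVertex (λ _ → false) (forest W)
  e₁ : F₁ ⊆G G
  e₁ = addVertex-⊆G {N = λ _ → false} {G = G} (embedding W) u∉W (λ _ ())
  v∉e₁ : ∀ i → proj₁ e₁ i ≢ v
  v∉e₁ fzero    = adj⇒≢ G v~u ∘ sym
  v∉e₁ (fsuc i) = v∉W i

grow : {G : Graph n} {k : ℕ} (W : RankedForestIn k G) {v u : Fin n} → Avoids W v →
  adj G v u ≡ true → RankedForestIn (suc k) G
grow W {u = u} v∉W v~u with any? (λ i → vertexMap W i ≟ u)
... | yes (i₀ , refl) = attachLeaf W v∉W i₀ v~u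
... | no  u∉W         = addEdge W v∉W (λ i → u∉W ∘ (i ,_)) v~u

largeDegreeSum⇒rankedForestIn : ∀ k (G : Graph n) → 2 * (k C 2) < degreeSum G → RankedForestIn k G
largeDegreeSum⇒rankedForestIn zero G _ = emptyForestIn G
largeDegreeSum⇒rankedForestIn {suc n} (suc k) G large with any? (λ w → suc k ≤? degree G w)
... | yes (w , big) = starForestIn G k big
... | no  noBig
  with v , 0<dv ← 0<∑⇒∃ (degree G) (≤-trans (s≤s z≤n) large)
  with g , _ , v~g ← ≤count⇒injection 1 (adj G v) 0<dv
  = grow (rankedForestIn-mono (largeDegreeSum⇒rankedForestIn k (removeVertex v G) largeRest)
                              (removeVertex-⊆G v G))
         (λ i → punchInᵢ≢i v _) (v~g fzero)
  where
  dv≤k : degree G v ≤ k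
  dv≤k = s≤s⁻¹ (≰⇒> (noBig ∘ (v ,_)))
  largeRest : 2 * (k C 2) < degreeSum (removeVertex v G)
  largeRest = m+n<o+p⇒o≤n⇒m<p
    (subst₂ _<_ (trans (cong (2 *_) ([1+k]C2≡kC2+k k)) (*-distribˡ-+ 2 (k C 2) k))
                (degreeSum-removeVertex v G) large)
    (*-monoʳ-≤ 2 dv≤k)

manyEdges⇒containsFk : ∀ k (G : Graph n) → k C 2 < edgeCount G → ContainsFk k G
manyEdges⇒containsFk k G many = rankedForestIn⇒containsFk k
  (largeDegreeSum⇒rankedForestIn k G (subst (2 * (k C 2) <_) (handshake G) (*-monoʳ-< 2 many)))

-- Dense graphs contain cycles

module NonBacktrackingWalk (G : Graph n) (w : ℕ → Fin n)
  (step : ∀ t → adj G (w t) (w (suc t)) ≡ true)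
  (noBacktrack : ∀ t → w (suc (suc t)) ≢ w t) where

  Revisits : ℕ → Set
  Revisits b = ∃ λ (a : Fin b) → w (toℕ a) ≡ w b

  InjectiveBelow : ℕ → Set
  InjectiveBelow b = ∀ {s t} → s < b → t < b → w s ≡ w t → s ≡ t

  noRevisit⇒injectiveBelow : ∀ {b} → (∀ {c} → c < b → ¬ Revisits c) → InjectiveBelow b
  noRevisit⇒injectiveBelow none {s} {t} s<b t<b ws≡wt with <-cmp s t
  ... | tri< s<t _ _ =
    contradiction (fromℕ< s<t , trans (cong w (toℕ-fromℕ< s<t)) ws≡wt) (none t<b)
  ... | tri≈ _ s≡t _ = s≡t
  ... | tri> _ _ t<s =
    contradiction (fromℕ< t<s , trans (cong w (toℕ-fromℕ< t<s)) (sym ws≡wt)) (none s<b)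

  closedSegment⇒cycle : ∀ a L → w a ≡ w (a + suc L) → InjectiveBelow (a + suc L) → Cycle G
  closedSegment⇒cycle a zero          closed _ =
    contradiction (trans closed (cong w (+-comm a 1))) (adj⇒≢ G (step a))
  closedSegment⇒cycle a (suc zero)    closed _ =
    contradiction (sym (trans closed (cong w (+-comm a 2)))) (noBacktrack a)
  closedSegment⇒cycle a (suc (suc ℓ)) closed inj = ℓ , c , c-inj , c-step , c-close
    where
    c : Fin (3 + ℓ) → Fin n
    c t = w (a + toℕ t)
    c-inj : Injective _≡_ _≡_ c
    c-inj {s} {t} = toℕ-injective ∘ +-cancelˡ-≡ a _ _
                  ∘ inj (+-monoʳ-< a (toℕ<n s)) (+-monoʳ-< a (toℕ<n t))
    c-step : ∀ i → adj G (c (inject₁ i)) (c (fsuc i)) ≡ true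
    c-step i = subst₂ (λ x y → adj G (w x) (w y) ≡ true)
      (cong (a +_) (sym (toℕ-inject₁ i))) (sym (+-suc a (toℕ i))) (step (a + toℕ i))
    c-close : adj G (c (fromℕ (2 + ℓ))) (c fzero) ≡ true
    c-close = subst₂ (λ x y → adj G (w x) y ≡ true)
      (cong (a +_) (sym (toℕ-fromℕ (2 + ℓ))))
      (trans (cong w (sym (+-suc a (2 + ℓ)))) (trans (sym closed) (cong w (sym (+-identityʳ a)))))
      (step (a + (2 + ℓ)))

  cycle : Cycle G
  cycle
    with i , j , i<j , wi≡wj ← pigeonhole (n<1+n n) (w ∘ toℕ)
    with b , (a , wa≡wb) , first ← leastWitness (λ b → any? λ (a : Fin b) → w (toℕ a) ≟ w b)
                                     (fromℕ< i<j , trans (cong w (toℕ-fromℕ< i<j)) wi≡wj)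
    = closedSegment⇒cycle (toℕ a) L (trans wa≡wb (cong w (sym a+1+L≡b)))
        (subst InjectiveBelow (sym a+1+L≡b) (noRevisit⇒injectiveBelow first))
    where
    L = b ∸ suc (toℕ a)
    a+1+L≡b : toℕ a + suc L ≡ b
    a+1+L≡b = trans (+-suc (toℕ a) L) (m+[n∸m]≡n (toℕ<n a))

minDegree2⇒cycle : (G : Graph n) → Fin n → (∀ v → 2 ≤ degree G v) → Cycle G
minDegree2⇒cycle {n} G x₀ deg≥2 = NonBacktrackingWalk.cycle G (proj₁ ∘ walk) step noBacktrack
  where
  neighbourAvoiding : (p c : Fin n) → ∃ λ j → j ≢ p × adj G c j ≡ true
  neighbourAvoiding p c with g , g-inj , c~g ← ≤count⇒injection 2 (adj G c) (deg≥2 c)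
    with g fzero ≟ p
  ... | no  g₀≢p = g fzero , g₀≢p , c~g fzero
  ... | yes g₀≡p =
    g (fsuc fzero) , (λ g₁≡p → contradiction (g-inj (trans g₀≡p (sym g₁≡p))) λ ()) , c~g (fsuc fzero)
  walk : ℕ → Fin n × Fin n
  walk zero    = x₀ , proj₁ (neighbourAvoiding x₀ x₀)
  walk (suc t) = proj₂ (walk t) , proj₁ (neighbourAvoiding (proj₁ (walk t)) (proj₂ (walk t)))
  step : ∀ t → adj G (proj₁ (walk t)) (proj₁ (walk (suc t))) ≡ true
  step zero    = proj₂ (proj₂ (neighbourAvoiding x₀ x₀))
  step (suc t) = proj₂ (proj₂ (neighbourAvoiding (proj₁ (walk t)) (proj₂ (walk t))))
  noBacktrack : ∀ t → proj₁ (walk (suc (suc t))) ≢ proj₁ (walk t)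
  noBacktrack t = proj₁ (proj₂ (neighbourAvoiding (proj₁ (walk t)) (proj₂ (walk t))))

dense⇒cycle : ∀ {m} (G : Graph (suc m)) → 2 * suc m ≤ degreeSum G → Cycle G
dense⇒cycle {zero} G dense rewrite adj-irrefl G fzero = contradiction dense λ ()
dense⇒cycle {suc m} G dense with any? (λ v → degree G v ≤? 1)
... | no  noLeaf = minDegree2⇒cycle G fzero (λ v → ≰⇒> (noLeaf ∘ (v ,_)))
... | yes (v , dv≤1) =
  cycle-⊆G {F = removeVertex v G} {G} (removeVertex-⊆G v G)
           (dense⇒cycle (removeVertex v G) denseRest)
  where
  denseRest : 2 * suc m ≤ degreeSum (removeVertex v G)
  denseRest = m+n≤o+p⇒o≤n⇒m≤p
    (subst₂ _≤_ (trans (*-suc 2 (suc m)) (+-comm 2 _)) (degreeSum-removeVertex v G) dense)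
    (*-monoʳ-≤ 2 dv≤1)

-- The extremal graph

-- The complete graph on the vertices 0, …, k - 1 (all of them if k > n), the others isolated.
clique : ℕ → ∀ n → Graph n
clique zero    n       = edgeless n
clique (suc k) zero    = edgeless zero
clique (suc k) (suc n) = addVertex (λ j → toℕ j <ᵇ k) (clique k n)

clique-adj⇒< : ∀ k (i j : Fin n) → adj (clique k n) i j ≡ true → toℕ i < k
clique-adj⇒< (suc k) fzero    _        _   = z<s
clique-adj⇒< (suc k) (fsuc i) fzero    i<k = s≤s (<ᵇ⇒< (toℕ i) k (subst T (sym i<k) _))
clique-adj⇒< (suc k) (fsuc i) (fsuc j) i~j = s≤s (clique-adj⇒< k i j i~j)

degreeSum-clique : ∀ {k n} → k ≤ n → degreeSum (clique k n) ≡ 2 * (k C 2)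
degreeSum-clique {zero}  {n}     _   = degreeSum-edgeless n
degreeSum-clique {suc k} {suc n} k<n = begin
  degreeSum (clique (suc k) (suc n))
    ≡⟨ degreeSum-addVertex _ (clique k n) ⟩
  2 * count {n} (λ j → toℕ j <ᵇ k) + degreeSum (clique k n)
    ≡⟨ cong₂ (λ d s → 2 * d + s) (count-<ᵇ (s≤s⁻¹ k<n)) (degreeSum-clique (s≤s⁻¹ k<n)) ⟩
  2 * k + 2 * (k C 2)  ≡⟨ *-distribˡ-+ 2 k (k C 2) ⟨
  2 * (k + k C 2)      ≡⟨ cong (2 *_) (trans (+-comm k _) (sym ([1+k]C2≡kC2+k k))) ⟩
  2 * (suc k C 2)      ∎
  where open ≡-Reasoning

edgeCount-clique : ∀ {k n} → k ≤ n → edgeCount (clique k n) ≡ k C 2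
edgeCount-clique {k} {n} k≤n =
  *-cancelˡ-≡ _ _ 2 (trans (handshake (clique k n)) (degreeSum-clique k≤n))

clique-Fk-free : ∀ {k n} → 1 ≤ k → ¬ ContainsFk k (clique k n)
clique-Fk-free {suc k} _ (zero , F , (_ , _ , ()) , _)
clique-Fk-free {k} {n} _ (suc m , F , (acyclic , noIsolated , edges) , f , f-inj , f-adj) =
  acyclic (dense⇒cycle F (begin
    2 * suc m       ≤⟨ *-monoʳ-≤ 2 (injective⇒≤ g-inj) ⟩
    2 * k           ≡⟨ cong (2 *_) edges ⟨
    2 * edgeCount F ≡⟨ handshake F ⟩
    degreeSum F     ∎))
  where
  open ≤-Reasoning
  inClique : ∀ x → toℕ (f x) < k
  inClique x = clique-adj⇒< k (f x) _ (f-adj x _ (proj₂ (noIsolated x)))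
  g : Fin (suc m) → Fin k
  g x = fromℕ< (inClique x)
  g-inj : Injective _≡_ _≡_ g
  g-inj {x} {y} = f-inj ∘ toℕ-injective ∘ fromℕ<-injective _ _ (inClique x) (inClique y)

lemma4p5 : (n k : ℕ) → 1 ≤ k → k ≤ n →
    ((G : Graph n) → k C 2 < edgeCount G → ContainsFk k G)
    × Σ (Graph n) (λ G → edgeCount G ≡ k C 2 × ¬ ContainsFk k G)
lemma4p5 n k 1≤k k≤n =
  manyEdges⇒containsFk k , clique k n , edgeCount-clique k≤n , clique-Fk-free 1≤k
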